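{- Let $n>2$ be an integer and $r\ge1$ an integer with $2^r+1<2^n$, and let $k=2^r+1$. Then the genus of $P_{2^r+1}(n)$ satisfies $g(P_{2^r+1}(n))\ge k\big(2^{n+1}+2^{2n-1}+2^{2n+r-1}-2^{n-1}\big)+2$.
   Context: $P_{2^r+1}(n)$ is the numerical semigroup consisting of all finite non-negative integer linear combinations of $\{(2^r+1)2^{n+i}+1\mid i\in\mathbb{N}\}$. The genus $g(S)$ of a numerical semigroup $S$ is the cardinality of $\mathbb{N}\setminus S$, where $\mathbb{N}$ is the set of non-negative integers. -}

module Defs where

open import Data.Nat using (ℕ; zero; suc; _+_; _*_; _^_)
open import Data.List using (List; length)
open import Data.List.Membership.Propositional using (_∈_)
open import Data.List.Relation.Unary.Unique.Propositional using (Unique)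
open import Data.Product using (Σ; _×_)
open import Relation.Nullary using (¬_)
open import Function.Bundles using (_⇔_)
open import Relation.Binary.PropositionalEquality using (_≡_)

gen : ℕ → ℕ → ℕ → ℕ
gen m n i = m * 2 ^ (n + i) + 1

data InP (m n : ℕ) : ℕ → Set where
  inP-zero : InP m n 0
  inP-add  : ∀ {x} (i : ℕ) → InP m n x → InP m n (x + gen m n i)

HasGenus : (ℕ → Set) → ℕ → Set
HasGenus S g =
  Σ (List ℕ) λ gaps →
    Unique gaps × ((x : ℕ) → (x ∈ gaps ⇔ (¬ S x))) × (length gaps ≡ g)

module Submission where

-- Write M = m 2^n, so that the i-th generator is 1 + 2^i M. An element built from j generators
-- with exponents i₁, …, i_j is j + s M with s = 2^i₁ + … + 2^i_j; hence j ≤ s, and j is at least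
-- the binary digit sum of s. For q, j < M this representation of j + q M is unique, so j + q M is
-- a gap whenever q < j or j is below the digit sum of q. Counting these gaps block by block gives
-- M (M - 1) / 2 plus a digit-sum term; for M = 8K this is at least 32K² + 16K - 8, which exceeds
-- the claimed bound 32K² + 12K + 2 as soon as K = (2^r + 1) 2^(n-3) ≥ 3. Every x ≥ M (M + 1) + M²
-- is a combination of the generators 1 + M and 1 + 2M, so the set of gaps is finite.

open import Data.List using (length; filter; downFrom)
open import Data.List.Membership.Propositional.Properties using (∈-filter⁺; ∈-filter⁻; ∈-downFrom⁺)
open import Data.List.Relation.Unary.Unique.Propositional.Properties using (filter⁺; downFrom⁺)
open import Data.Nat
open import Data.Nat.DivMod using (_/_; _%_; m%n<n; m≡m%n+[m/n]*n)
open import Data.Nat.Induction using (<-rec)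
open import Data.Nat.Properties
open import Data.Nat.Tactic.RingSolver using (solve-∀)
open import Algebra.Properties.CommutativeSemigroup +-commutativeSemigroup using (interchange; x∙yz≈y∙xz)
open import Data.Product using (Σ; ∃; ∃₂; _×_; _,_; proj₁; proj₂)
open import Data.Sum using (_⊎_; inj₁; inj₂; [_,_])
open import Function using (_∘_)
open import Function.Bundles using (mk⇔)
open import Relation.Binary.Definitions using (tri<; tri≈; tri>)
open import Relation.Binary.PropositionalEquality hiding ([_])
open import Relation.Nullary using (Dec; yes; no; ¬_; ¬?; _⊎-dec_; contradiction; map′)
open import Relation.Nullary.Decidable using (from-yes)
open import Relation.Unary using (Decidable)

open import Defs

sumBelow : ℕ → (ℕ → ℕ) → ℕ
sumBelow zero    f = 0
sumBelow (suc N) f = f N + sumBelow N f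

module _ {f g : ℕ → ℕ} where

  sumBelow-cong : ∀ N → (∀ x → x < N → f x ≡ g x) → sumBelow N f ≡ sumBelow N g
  sumBelow-cong zero    _  = refl
  sumBelow-cong (suc N) eq =
    cong₂ _+_ (eq N ≤-refl) (sumBelow-cong N (λ x x<N → eq x (m<n⇒m<1+n x<N)))

  sumBelow-mono : ∀ N → (∀ x → x < N → f x ≤ g x) → sumBelow N f ≤ sumBelow N g
  sumBelow-mono zero    _  = z≤n
  sumBelow-mono (suc N) le =
    +-mono-≤ (le N ≤-refl) (sumBelow-mono N (λ x x<N → le x (m<n⇒m<1+n x<N)))

  sumBelow-+ : ∀ N → sumBelow N (λ x → f x + g x) ≡ sumBelow N f + sumBelow N g
  sumBelow-+ zero    = refl
  sumBelow-+ (suc N) =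
    trans (cong (f N + g N +_) (sumBelow-+ N)) (interchange (f N) (g N) _ _)

module _ {f : ℕ → ℕ} where

  sumBelow-const : ∀ N {c} → (∀ x → x < N → f x ≡ c) → sumBelow N f ≡ N * c
  sumBelow-const zero    _  = refl
  sumBelow-const (suc N) eq =
    cong₂ _+_ (eq N ≤-refl) (sumBelow-const N (λ x x<N → eq x (m<n⇒m<1+n x<N)))

  sumBelow-split : ∀ N X → sumBelow (N + X) f ≡ sumBelow N (λ x → f (x + X)) + sumBelow X f
  sumBelow-split zero    X = refl
  sumBelow-split (suc N) X =
    trans (cong (f (N + X) +_) (sumBelow-split N X)) (sym (+-assoc (f (N + X)) _ _))

  sumBelow-monoˡ : ∀ {N N′} → N ≤ N′ → sumBelow N f ≤ sumBelow N′ f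
  sumBelow-monoˡ {N} {N′} N≤N′ = begin
    sumBelow N f                                       ≤⟨ m≤n+m _ _ ⟩
    sumBelow (N′ ∸ N) (λ x → f (x + N)) + sumBelow N f ≡⟨ sym (sumBelow-split (N′ ∸ N) N) ⟩
    sumBelow (N′ ∸ N + N) f                            ≡⟨ cong (λ L → sumBelow L f) (m∸n+n≡m N≤N′) ⟩
    sumBelow N′ f                                      ∎
    where open ≤-Reasoning

  sumBelow-blocks : ∀ Q M → sumBelow (Q * M) f ≡ sumBelow Q (λ q → sumBelow M (λ x → f (x + q * M)))
  sumBelow-blocks zero    M = refl
  sumBelow-blocks (suc Q) M =
    trans (sumBelow-split M (Q * M)) (cong (sumBelow M (λ x → f (x + Q * M)) +_) (sumBelow-blocks Q M))

sumBelow-countdown : ∀ N → 2 * sumBelow N (λ q → N ∸ suc q) + N ≡ N * N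
sumBelow-countdown zero    = refl
sumBelow-countdown (suc N) = begin
  2 * (N ∸ N + sumBelow N (λ q → N ∸ q)) + suc N
    ≡⟨ cong₂ (λ z s → 2 * (z + s) + suc N) (n∸n≡0 N)
             (sumBelow-cong N (λ q q<N → +-∸-assoc 1 q<N)) ⟩
  2 * sumBelow N (λ q → 1 + (N ∸ suc q)) + suc N
    ≡⟨ cong (λ s → 2 * s + suc N)
            (trans (sumBelow-+ N) (cong (_+ S) (trans (sumBelow-const N (λ _ _ → refl)) (*-identityʳ N)))) ⟩
  2 * (N + S) + suc N
    ≡⟨ regroup N S ⟩
  (2 * S + N) + suc (2 * N)
    ≡⟨ cong (_+ suc (2 * N)) (sumBelow-countdown N) ⟩
  N * N + suc (2 * N)
    ≡⟨ square-suc N ⟩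
  suc N * suc N ∎
  where
  open ≡-Reasoning
  S : ℕ
  S = sumBelow N (λ q → N ∸ suc q)
  regroup : ∀ N S → 2 * (N + S) + suc N ≡ (2 * S + N) + suc (2 * N)
  regroup = solve-∀
  square-suc : ∀ N → N * N + suc (2 * N) ≡ suc N * suc N
  square-suc = solve-∀

indicator : {A : Set} → Dec A → ℕ
indicator (yes _) = 1
indicator (no _)  = 0

indicator-yes : {A : Set} (a? : Dec A) → A → indicator a? ≡ 1
indicator-yes (yes _) _ = refl
indicator-yes (no ¬a) a = contradiction a ¬a

indicator-mono : {A B : Set} (a? : Dec A) (b? : Dec B) → (A → B) → indicator a? ≤ indicator b?
indicator-mono (yes a) b? f = ≤-reflexive (sym (indicator-yes b? (f a)))
indicator-mono (no _)  _  _ = z≤n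

count : {P : ℕ → Set} → Decidable P → ℕ → ℕ
count P? N = sumBelow N (λ x → indicator (P? x))

module _ {P : ℕ → Set} (P? : Decidable P) where

  length-filter-downFrom : ∀ N → length (filter P? (downFrom N)) ≡ count P? N
  length-filter-downFrom zero = refl
  length-filter-downFrom (suc N) with P? N
  ... | yes _ = cong suc (length-filter-downFrom N)
  ... | no _  = length-filter-downFrom N

  count-all : ∀ N → (∀ x → x < N → P x) → count P? N ≡ N
  count-all N all = trans (sumBelow-const N (λ x x<N → indicator-yes (P? x) (all x x<N))) (*-identityʳ N)

  count-mono : {Q : ℕ → Set} (Q? : Decidable Q) →
               ∀ N → (∀ x → x < N → P x → Q x) → count P? N ≤ count Q? N
  count-mono Q? N P⇒Q = sumBelow-mono N (λ x x<N → indicator-mono (P? x) (Q? x) (P⇒Q x x<N))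

count-outside : ∀ {a q N} → a ≤ q → q < N →
                a + (N ∸ suc q) ≤ count (λ x → (x <? a) ⊎-dec (q <? x)) N
count-outside {a} {q} {N} a≤q q<N = begin
  a + (N ∸ suc q)
    ≡⟨ +-comm a _ ⟩
  (N ∸ suc q) + a
    ≡⟨ cong₂ _+_ (sym (count-all (Out? ∘ (_+ suc q)) _ above)) (sym (count-all Out? a (λ _ → inj₁))) ⟩
  count (Out? ∘ (_+ suc q)) (N ∸ suc q) + count Out? a
    ≤⟨ +-monoʳ-≤ _ (sumBelow-monoˡ (m≤n⇒m≤1+n a≤q)) ⟩
  count (Out? ∘ (_+ suc q)) (N ∸ suc q) + count Out? (suc q)
    ≡⟨ sym (sumBelow-split (N ∸ suc q) (suc q)) ⟩
  count Out? (N ∸ suc q + suc q)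
    ≡⟨ cong (count Out?) (m∸n+n≡m q<N) ⟩
  count Out? N ∎
  where
  open ≤-Reasoning
  Out? : Decidable (λ x → x < a ⊎ q < x)
  Out? x = (x <? a) ⊎-dec (q <? x)
  above : ∀ x → x < N ∸ suc q → x + suc q < a ⊎ q < x + suc q
  above x _ = inj₂ (m≤n+m (suc q) x)

hasGenus-count : {S : ℕ → Set} (S? : Decidable S) (B : ℕ) →
                 (∀ x → B ≤ x → S x) → HasGenus S (count (¬? ∘ S?) B)
hasGenus-count {S} S? B large =
  filter (¬? ∘ S?) (downFrom B) ,
  filter⁺ (¬? ∘ S?) (downFrom⁺ B) ,
  (λ x → mk⇔ (proj₂ ∘ ∈-filter⁻ (¬? ∘ S?) {xs = downFrom B})
             (λ x∉S → ∈-filter⁺ (¬? ∘ S?) (∈-downFrom⁺ (gap<B x∉S)) x∉S)) ,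
  length-filter-downFrom (¬? ∘ S?) B
  where
  gap<B : ∀ {x} → ¬ S x → x < B
  gap<B {x} x∉S with B ≤? x
  ... | yes B≤x = contradiction (large x B≤x) x∉S
  ... | no B≰x  = ≰⇒> B≰x

lowDigitSum : ℕ → ℕ
lowDigitSum 0 = 0
lowDigitSum 1 = 1
lowDigitSum 2 = 1
lowDigitSum 3 = 2
lowDigitSum 4 = 1
lowDigitSum 5 = 2
lowDigitSum 6 = 2
lowDigitSum 7 = 3
lowDigitSum (suc (suc (suc (suc (suc (suc (suc (suc s)))))))) = lowDigitSum s

-- A lower bound for the binary digit sum of s which, unlike the digit sum itself, sums exactly
-- over blocks of eight.
weight : ℕ → ℕ
weight s = indicator (8 ≤? s) + lowDigitSum s

lowDigitSum-periodic : ∀ c s → lowDigitSum (c * 8 + s) ≡ lowDigitSum s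
lowDigitSum-periodic zero    s = refl
lowDigitSum-periodic (suc c) s = lowDigitSum-periodic c s

weight-beyond-8 : ∀ c s → weight (suc c * 8 + s) ≡ suc (lowDigitSum s)
weight-beyond-8 c s =
  cong₂ _+_ (indicator-yes (8 ≤? suc c * 8 + s) (m≤m+n 8 _)) (lowDigitSum-periodic c s)

weight-+-*8 : ∀ c s → weight (c * 8 + s) ≤ suc (weight s)
weight-+-*8 zero    s = n≤1+n (weight s)
weight-+-*8 (suc c) s = begin
  weight (suc c * 8 + s) ≡⟨ weight-beyond-8 c s ⟩
  suc (lowDigitSum s)    ≤⟨ s≤s (m≤n+m (lowDigitSum s) _) ⟩
  suc (weight s)         ∎
  where open ≤-Reasoning

weight-+-2^-below8 : ∀ {i} → i < 3 → ∀ {s} → s < 8 → weight (2 ^ i + s) ≤ suc (weight s)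
weight-+-2^-below8 = from-yes (allUpTo? (λ i → allUpTo? (λ s → weight (2 ^ i + s) ≤? suc (weight s)) 8) 3)

lowDigitSum-+-2^-below8 : ∀ {i} → i < 3 → ∀ {s} → s < 8 → lowDigitSum (2 ^ i + s) ≤ suc (lowDigitSum s)
lowDigitSum-+-2^-below8 =
  from-yes (allUpTo? (λ i → allUpTo? (λ s → lowDigitSum (2 ^ i + s) ≤? suc (lowDigitSum s)) 8) 3)

div-mod-8 : ∀ s → ∃₂ λ c t → t < 8 × s ≡ c * 8 + t
div-mod-8 s = s / 8 , s % 8 , m%n<n s 8 , trans (m≡m%n+[m/n]*n s 8) (+-comm (s % 8) _)

weight-+-small-2^ : ∀ {i} → i < 3 → ∀ s → weight (2 ^ i + s) ≤ suc (weight s)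
weight-+-small-2^ i<3 s with div-mod-8 s
... | zero  , t , t<8 , refl = weight-+-2^-below8 i<3 t<8
weight-+-small-2^ {i} i<3 s | suc c , t , t<8 , refl = begin
  weight (2 ^ i + (suc c * 8 + t)) ≡⟨ cong weight (x∙yz≈y∙xz (2 ^ i) (suc c * 8) t) ⟩
  weight (suc c * 8 + (2 ^ i + t)) ≡⟨ weight-beyond-8 c _ ⟩
  suc (lowDigitSum (2 ^ i + t))    ≤⟨ s≤s (lowDigitSum-+-2^-below8 i<3 t<8) ⟩
  suc (suc (lowDigitSum t))        ≡⟨ cong suc (sym (weight-beyond-8 c t)) ⟩
  suc (weight (suc c * 8 + t))     ∎
  where open ≤-Reasoning

weight-+-2^ : ∀ i s → weight (2 ^ i + s) ≤ suc (weight s)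
weight-+-2^ 0 = weight-+-small-2^ (s≤s z≤n)
weight-+-2^ 1 = weight-+-small-2^ (s≤s (s≤s z≤n))
weight-+-2^ 2 = weight-+-small-2^ ≤-refl
weight-+-2^ (suc (suc (suc i))) s =
  subst (λ d → weight (d + s) ≤ suc (weight s)) (sym (2^[3+i] (2 ^ i))) (weight-+-*8 (2 ^ i) s)
  where
  2^[3+i] : ∀ x → 2 * (2 * (2 * x)) ≡ x * 8
  2^[3+i] = solve-∀

data SumOfPowersOfTwo : ℕ → ℕ → Set where
  []  : SumOfPowersOfTwo 0 0
  _∷_ : ∀ {j s} i → SumOfPowersOfTwo j s → SumOfPowersOfTwo (suc j) (2 ^ i + s)

terms≤sum : ∀ {j s} → SumOfPowersOfTwo j s → j ≤ s
terms≤sum []       = z≤n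
terms≤sum (i ∷ ps) = +-mono-≤ (m^n>0 2 i) (terms≤sum ps)

weight≤terms : ∀ {j s} → SumOfPowersOfTwo j s → weight s ≤ j
weight≤terms []       = z≤n
weight≤terms (i ∷ ps) = ≤-trans (weight-+-2^ i _) (s≤s (weight≤terms ps))

sum-of-ones : ∀ s → SumOfPowersOfTwo s s
sum-of-ones zero    = []
sum-of-ones (suc s) = 0 ∷ sum-of-ones s

weight≤ : ∀ s → weight s ≤ s
weight≤ s = weight≤terms (sum-of-ones s)

sumBelow-weight : ∀ K → sumBelow (suc K * 8) weight ≡ 12 + 20 * K
sumBelow-weight zero    = refl
sumBelow-weight (suc K) = begin
  sumBelow (8 + suc K * 8) weight
    ≡⟨ sumBelow-split {weight} 8 (suc K * 8) ⟩
  sumBelow 8 (λ x → weight (x + suc K * 8)) + sumBelow (suc K * 8) weight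
    ≡⟨ cong₂ _+_ (sumBelow-cong 8 (λ x _ → trans (cong weight (+-comm x (suc K * 8))) (weight-beyond-8 K x)))
                 (sumBelow-weight K) ⟩
  sumBelow 8 (λ x → suc (lowDigitSum x)) + (12 + 20 * K)
    ≡⟨⟩
  20 + (12 + 20 * K)
    ≡⟨ regroup K ⟩
  12 + 20 * suc K ∎
  where
  open ≡-Reasoning
  regroup : ∀ K → 20 + (12 + 20 * K) ≡ 12 + 20 * suc K
  regroup = solve-∀

digits-unique : ∀ {M s q a b} → a ≤ s → q < M → b < M → a + s * M ≡ b + q * M → s ≡ q
digits-unique {M} {s} {q} {a} {b} a≤s q<M b<M eq with <-cmp s q
... | tri≈ _ s≡q _ = s≡q
... | tri< s<q _ _ = contradiction eq (<⇒≢ (begin-strict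
  a + s * M ≤⟨ +-monoˡ-≤ _ a≤s ⟩
  s + s * M <⟨ +-monoˡ-< _ (<-trans s<q q<M) ⟩
  suc s * M ≤⟨ *-monoˡ-≤ M s<q ⟩
  q * M     ≤⟨ m≤n+m _ b ⟩
  b + q * M ∎))
  where open ≤-Reasoning
... | tri> _ _ q<s = contradiction (sym eq) (<⇒≢ (begin-strict
  b + q * M <⟨ +-monoˡ-< _ b<M ⟩
  suc q * M ≤⟨ *-monoˡ-≤ M q<s ⟩
  s * M     ≤⟨ m≤n+m _ a ⟩
  a + s * M ∎))
  where open ≤-Reasoning

-- With x ∸ B = q (1 + M) + ρ and ρ ≤ M, take (2ρ + q) copies of 1 + M and M ∸ ρ copies of 1 + 2M.
combination-of-1+M-1+2M : ∀ M x → M * suc M + M * M ≤ x →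
                          ∃₂ λ c d → x ≡ c * suc M + d * suc (M + M)
combination-of-1+M-1+2M M x B≤x = 2 * ρ + q , d , (begin
  x                                       ≡⟨ sym (m+[n∸m]≡n B≤x) ⟩
  M * suc M + M * M + (x ∸ B)             ≡⟨ cong (M * suc M + M * M +_) (m≡m%n+[m/n]*n (x ∸ B) (suc M)) ⟩
  M * suc M + M * M + (ρ + q * suc M)     ≡⟨ cong (λ L → L * suc L + L * L + (ρ + q * suc L)) M≡ρ+d ⟩
  (ρ + d) * suc (ρ + d) + (ρ + d) * (ρ + d) + (ρ + q * suc (ρ + d))
                                          ≡⟨ regroup ρ d q ⟩
  (2 * ρ + q) * suc (ρ + d) + d * suc ((ρ + d) + (ρ + d))
                                          ≡⟨ cong (λ L → (2 * ρ + q) * suc L + d * suc (L + L)) (sym M≡ρ+d) ⟩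
  (2 * ρ + q) * suc M + d * suc (M + M)   ∎)
  where
  open ≡-Reasoning
  B ρ q d : ℕ
  B = M * suc M + M * M
  ρ = (x ∸ B) % suc M
  q = (x ∸ B) / suc M
  d = M ∸ ρ
  M≡ρ+d : M ≡ ρ + d
  M≡ρ+d = sym (m+[n∸m]≡n (≤-pred (m%n<n (x ∸ B) (suc M))))
  regroup : ∀ ρ d q → (ρ + d) * suc (ρ + d) + (ρ + d) * (ρ + d) + (ρ + q * suc (ρ + d))
                    ≡ (2 * ρ + q) * suc (ρ + d) + d * suc ((ρ + d) + (ρ + d))
  regroup = solve-∀

n<2^n : ∀ n → n < 2 ^ n
n<2^n zero    = s≤s z≤n
n<2^n (suc n) = +-mono-≤ (m^n>0 2 n) (≤-trans (n<2^n n) (m≤m+n (2 ^ n) 0))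

forcedGaps : ℕ → ℕ
forcedGaps M = sumBelow M weight + sumBelow M (λ q → M ∸ suc q)

module P (m n : ℕ) where

  M : ℕ
  M = m * 2 ^ n

  gen≡ : ∀ i → gen m n i ≡ suc (2 ^ i * M)
  gen≡ i = trans (cong (λ p → m * p + 1) (^-distribˡ-+-* 2 n i)) (regroup m (2 ^ n) (2 ^ i))
    where
    regroup : ∀ m N I → m * (N * I) + 1 ≡ suc (I * (m * N))
    regroup = solve-∀

  InP-*-gen : ∀ c i {y} → InP m n y → InP m n (c * gen m n i + y)
  InP-*-gen zero    i y∈P = y∈P
  InP-*-gen (suc c) i y∈P =
    subst (InP m n) (trans (+-comm _ (gen m n i)) (sym (+-assoc (gen m n i) _ _)))
          (inP-add i (InP-*-gen c i y∈P))

  gapBound : ℕ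
  gapBound = M * suc M + M * M

  InP-beyond-gapBound : ∀ x → gapBound ≤ x → InP m n x
  InP-beyond-gapBound x B≤x with combination-of-1+M-1+2M M x B≤x
  ... | c , d , x≡ = subst (InP m n) (sym x≡′) (InP-*-gen c 0 (InP-*-gen d 1 inP-zero))
    where
    regroup : ∀ c d M → c * suc M + d * suc (M + M) ≡ c * suc (1 * M) + (d * suc (2 * M) + 0)
    regroup = solve-∀
    x≡′ : x ≡ c * gen m n 0 + (d * gen m n 1 + 0)
    x≡′ = trans x≡ (trans (regroup c d M)
                          (sym (cong₂ (λ g₀ g₁ → c * g₀ + (d * g₁ + 0)) (gen≡ 0) (gen≡ 1))))

  InP⇒sum-of-powers : ∀ {x} → InP m n x → ∃₂ λ j s → SumOfPowersOfTwo j s × x ≡ j + s * M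
  InP⇒sum-of-powers inP-zero = 0 , 0 , [] , refl
  InP⇒sum-of-powers (inP-add i x∈P) with InP⇒sum-of-powers x∈P
  ... | j , s , ps , refl = suc j , 2 ^ i + s , i ∷ ps , trans (cong (j + s * M +_) (gen≡ i)) (regroup j s M (2 ^ i))
    where
    regroup : ∀ j s M I → j + s * M + suc (I * M) ≡ suc j + (I + s) * M
    regroup = solve-∀

  forced-gap : ∀ {q j} → q < M → j < M → j < weight q ⊎ q < j → ¬ InP m n (j + q * M)
  forced-gap {q} {j} q<M j<M outside x∈P with InP⇒sum-of-powers x∈P
  ... | j′ , s , ps , eq with digits-unique (terms≤sum ps) q<M j<M (sym eq)
  ... | refl with +-cancelʳ-≡ (q * M) j j′ eq
  ... | refl = [ (λ j<w → <⇒≱ j<w (weight≤terms ps)) , (λ q<j → <⇒≱ q<j (terms≤sum ps)) ] outside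

  InP-last : ∀ {x} → InP m n x → x ≡ 0 ⊎ ∃ λ i → gen m n i ≤ x × InP m n (x ∸ gen m n i)
  InP-last inP-zero             = inj₁ refl
  InP-last (inP-add {y} i y∈P) = inj₂ (i , m≤n+m _ y , subst (InP m n) (sym (m+n∸n≡m y (gen m n i))) y∈P)

  module _ (m≥1 : 1 ≤ m) where

    i<gen : ∀ i → i < gen m n i
    i<gen i = begin-strict
      i                 <⟨ n<2^n i ⟩
      2 ^ i             ≤⟨ ^-monoʳ-≤ 2 (m≤n+m i n) ⟩
      2 ^ (n + i)       ≤⟨ m≤n*m _ m {{>-nonZero m≥1}} ⟩
      m * 2 ^ (n + i)   <⟨ m<m+n _ z<s ⟩
      gen m n i         ∎
      where open ≤-Reasoning

    InP? : Decidable (InP m n)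
    InP? = <-rec _ decide
      where
      decide : ∀ x → (∀ {y} → y < x → Dec (InP m n y)) → Dec (InP m n x)
      decide zero    _   = yes inP-zero
      decide (suc x) rec = map′ add-last last (anyUpTo? removable? (suc x))
        where
        Removable : ℕ → Set
        Removable i = gen m n i ≤ suc x × InP m n (suc x ∸ gen m n i)
        removable? : Decidable Removable
        removable? i with gen m n i ≤? suc x
        ... | no  g≰x = no (g≰x ∘ proj₁)
        ... | yes g≤x = map′ (g≤x ,_) proj₂ (rec (∸-monoʳ-< (m≤n+m 1 _) g≤x))
        add-last : (∃ λ i → i < suc x × Removable i) → InP m n (suc x)
        add-last (i , _ , g≤x , rest) = subst (InP m n) (m∸n+n≡m g≤x) (inP-add i rest)
        last : InP m n (suc x) → ∃ λ i → i < suc x × Removable i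
        last x∈P with InP-last x∈P
        ... | inj₂ (i , g≤x , rest) = i , <-≤-trans (i<gen i) g≤x , g≤x , rest

    gap? : Decidable (λ x → ¬ InP m n x)
    gap? = ¬? ∘ InP?

    genus : ℕ
    genus = count gap? gapBound

    hasGenus : HasGenus (InP m n) genus
    hasGenus = hasGenus-count InP? gapBound InP-beyond-gapBound

    forcedGaps≤genus : forcedGaps M ≤ genus
    forcedGaps≤genus = begin
      sumBelow M weight + sumBelow M (λ q → M ∸ suc q)     ≡⟨ sym (sumBelow-+ M) ⟩
      sumBelow M (λ q → weight q + (M ∸ suc q))            ≤⟨ sumBelow-mono M block ⟩
      sumBelow M (λ q → count (λ j → gap? (j + q * M)) M)  ≡⟨ sym (sumBelow-blocks M M) ⟩
      count gap? (M * M)                                   ≤⟨ sumBelow-monoˡ (m≤n+m (M * M) (M * suc M)) ⟩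
      count gap? gapBound                                  ∎
      where
      open ≤-Reasoning
      block : ∀ q → q < M → weight q + (M ∸ suc q) ≤ count (λ j → gap? (j + q * M)) M
      block q q<M = ≤-trans (count-outside (weight≤ q) q<M)
                            (count-mono (λ j → (j <? weight q) ⊎-dec (q <? j)) (λ j → gap? (j + q * M)) M
                                        (λ j j<M → forced-gap q<M j<M))

forcedGaps-*8 : ∀ K → 3 ≤ K → 32 * (K * K) + 12 * K + 2 ≤ forcedGaps (K * 8)
-- Doubling lets sumBelow-countdown enter; the slack 4 + 8t is where K ≥ 3 is needed.
forcedGaps-*8 (suc (suc (suc t))) (s≤s (s≤s (s≤s _))) = *-cancelˡ-≤ 2 (+-cancelʳ-≤ (K * 8) _ _ (begin
  2 * (32 * (K * K) + 12 * K + 2) + K * 8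
    ≤⟨ m≤m+n _ (4 + 8 * t) ⟩
  2 * (32 * (K * K) + 12 * K + 2) + K * 8 + (4 + 8 * t)
    ≡⟨ regroup t ⟩
  2 * W + (K * 8) * (K * 8)
    ≡⟨ cong (2 * W +_) (sym (sumBelow-countdown (K * 8))) ⟩
  2 * W + (2 * T + K * 8)
    ≡⟨ distrib W T (K * 8) ⟩
  2 * (W + T) + K * 8
    ≡⟨ cong (λ W → 2 * (W + T) + K * 8) (sym (sumBelow-weight (2 + t))) ⟩
  2 * (sumBelow (K * 8) weight + T) + K * 8 ∎))
  where
  open ≤-Reasoning
  K W T : ℕ
  K = 3 + t
  W = 12 + 20 * (2 + t)
  T = sumBelow (K * 8) (λ q → K * 8 ∸ suc q)
  regroup : ∀ t → let K = 3 + t in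
            2 * (32 * (K * K) + 12 * K + 2) + K * 8 + (4 + 8 * t) ≡ 2 * (12 + 20 * (2 + t)) + (K * 8) * (K * 8)
  regroup = solve-∀
  distrib : ∀ W T L → 2 * W + (2 * T + L) ≡ 2 * (W + T) + L
  distrib = solve-∀

bound-closed-form : ∀ a r → let n = 3 + a; k = 2 ^ r + 1; K = k * 2 ^ a in
  k * ((2 ^ (n + 1) + 2 ^ (2 * n ∸ 1) + 2 ^ (2 * n + r ∸ 1)) ∸ 2 ^ (n ∸ 1)) + 2 ≡ 32 * (K * K) + 12 * K + 2
bound-closed-form a r = begin
  k * ((2 ^ (n + 1) + 2 ^ (2 * n ∸ 1) + 2 ^ (2 * n + r ∸ 1)) ∸ 2 * (2 * A)) + 2
    ≡⟨ cong (λ e → k * (e ∸ 2 * (2 * A)) + 2) powers ⟩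
  k * (12 * A + 32 * (A * A) + 32 * (A * A * R) + 2 * (2 * A) ∸ 2 * (2 * A)) + 2
    ≡⟨ cong (λ e → k * e + 2) (m+n∸n≡m _ (2 * (2 * A))) ⟩
  k * (12 * A + 32 * (A * A) + 32 * (A * A * R)) + 2
    ≡⟨ regroup A R ⟩
  32 * (K * K) + 12 * K + 2 ∎
  where
  open ≡-Reasoning
  n A R k K : ℕ
  n = 3 + a
  A = 2 ^ a
  R = 2 ^ r
  k = R + 1
  K = k * A
  double : ∀ a → 2 * (3 + a) ≡ 6 + (a + a)
  double = solve-∀
  times16 : ∀ x → 2 * (2 * (2 * x)) * 2 ≡ 16 * x
  times16 = solve-∀
  times32 : ∀ x → 2 * (2 * (2 * (2 * (2 * x)))) ≡ 32 * x
  times32 = solve-∀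
  2^2a : 2 ^ (a + a) ≡ A * A
  2^2a = ^-distribˡ-+-* 2 a a
  powers : 2 ^ (n + 1) + 2 ^ (2 * n ∸ 1) + 2 ^ (2 * n + r ∸ 1)
         ≡ 12 * A + 32 * (A * A) + 32 * (A * A * R) + 2 * (2 * A)
  powers = begin
    2 ^ (n + 1) + 2 ^ (2 * n ∸ 1) + 2 ^ (2 * n + r ∸ 1)
      ≡⟨ cong₂ (λ e f → 2 ^ (n + 1) + 2 ^ (e ∸ 1) + 2 ^ (f ∸ 1)) (double a) (cong (_+ r) (double a)) ⟩
    2 ^ (n + 1) + 2 ^ (5 + (a + a)) + 2 ^ (5 + (a + a + r))
      ≡⟨ cong₂ _+_ (cong₂ _+_ (trans (^-distribˡ-+-* 2 n 1) (times16 A))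
                              (trans (times32 (2 ^ (a + a))) (cong (32 *_) 2^2a)))
                   (trans (times32 (2 ^ (a + a + r)))
                          (cong (32 *_) (trans (^-distribˡ-+-* 2 (a + a) r) (cong (_* R) 2^2a)))) ⟩
    16 * A + 32 * (A * A) + 32 * (A * A * R)
      ≡⟨ split-16 A (32 * (A * A)) (32 * (A * A * R)) ⟩
    12 * A + 32 * (A * A) + 32 * (A * A * R) + 2 * (2 * A) ∎
    where
    split-16 : ∀ A X Y → 16 * A + X + Y ≡ 12 * A + X + Y + 2 * (2 * A)
    split-16 = solve-∀
  regroup : ∀ A R → (R + 1) * (12 * A + 32 * (A * A) + 32 * (A * A * R)) + 2
                  ≡ 32 * (((R + 1) * A) * ((R + 1) * A)) + 12 * ((R + 1) * A) + 2
  regroup = solve-∀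

corollary1 : (n r : ℕ) → 2 < n → 1 ≤ r → 2 ^ r + 1 < 2 ^ n →
    Σ ℕ λ g → HasGenus (InP (2 ^ r + 1) n) g ×
      (g ≥ (2 ^ r + 1) * ((2 ^ (n + 1) + 2 ^ (2 * n ∸ 1) + 2 ^ (2 * n + r ∸ 1)) ∸ 2 ^ (n ∸ 1)) + 2)
corollary1 (suc (suc (suc a))) r (s≤s (s≤s (s≤s _))) r≥1 _ = genus m≥1 , hasGenus m≥1 , (begin
  _                          ≡⟨ bound-closed-form a r ⟩
  32 * (K * K) + 12 * K + 2  ≤⟨ forcedGaps-*8 K K≥3 ⟩
  forcedGaps (K * 8)         ≡⟨ cong forcedGaps (sym M≡K*8) ⟩
  forcedGaps M               ≤⟨ forcedGaps≤genus m≥1 ⟩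
  genus m≥1                  ∎)
  where
  open P (2 ^ r + 1) (3 + a)
  open ≤-Reasoning
  K : ℕ
  K = (2 ^ r + 1) * 2 ^ a
  m≥1 : 1 ≤ 2 ^ r + 1
  m≥1 = m≤n+m 1 _
  K≥3 : 3 ≤ K
  K≥3 = *-mono-≤ (+-monoˡ-≤ 1 (^-monoʳ-≤ 2 r≥1)) (m^n>0 2 a)
  M≡K*8 : M ≡ K * 8
  M≡K*8 = regroup (2 ^ r + 1) (2 ^ a)
    where
    regroup : ∀ k P → k * (2 * (2 * (2 * P))) ≡ k * P * 8
    regroup = solve-∀
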